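{- Let $R$ be a subring of $\mathbb{Q}$, let $G$ be a torsion-free $R$-module whose nucleus is $R$, and let $G'$ be an $n$-free-by-1 $R$-module for some $n\le\omega$ (with data $p_m,k_{im}$ as in the context). Then ${\rm Ext}(G',G)=0$ if and only if $G$ is $G'$-complete.
   Context: The nucleus of a nonzero torsion-free abelian group $G$ is the largest subring $R\subseteq\mathbb{Q}$ such that $G$ is an $R$-module. For $n\le\omega$, an $n$-free-by-1 $R$-module is a module of the form $G'=B/N$, where $B=\bigoplus_{i<n}x_iR\oplus\bigoplus_{m\in\omega}y_mR$ is a free $R$-module and $N$ is the submodule generated by the elements $y_{m+1}p_m-y_m-\sum_{i<n}x_ik_{im}$ ($m\in\omega$), where $p_m,k_{im}\in R$, the $p_m$ are nonzero and form a divisibility chain ($p_j$ divides $p_m$ in $R$ for $j\le m$), and for each $m$ only finitely many $k_{im}$ are nonzero. Equivalently $G'$ is generated by $y'_m$ ($m\in\omega$) and a free module $\bigoplus_{i<n}x'_iR$ subject only to the relations $y'_{m+1}p_m=y'_m+\sum_{i<n}x'_ik_{im}$. It is assumed that $G'$ is not free, i.e. the rank-one quotient $G'/\bigoplus_{i<n}x'_iR$ is not isomorphic to $R$. A torsion-free $R$-module $G$ is $G'$-complete if for every sequence $(c_m)_{m\in\omega}$ of elements of $G$ the system of equations $y_{m+1}p_m=y_m+\sum_{i<n}x_ik_{im}+c_m$ ($m\in\omega$) has a solution $y_m,x_i\in G$ ($m\in\omega$, $i<n$). For torsion-free $R$-modules Ext over $R$ and over $\mathbb{Z}$ coincide. 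-}

module Defs where

open import Level using (0ℓ)
open import Data.Nat as ℕ using (ℕ; zero; suc; _≤_)
open import Data.Fin as Fin using (Fin)
open import Data.Rational as ℚ using (ℚ; 0ℚ; 1ℚ)
open import Data.List using (List; []; _∷_; _++_; map; foldr; allFin; upTo)
open import Data.Product using (Σ; Σ-syntax; ∃; ∃-syntax; _×_; _,_; proj₁; proj₂)
open import Data.Unit using (⊤)
open import Data.Empty using (⊥)
open import Relation.Nullary using (¬_; yes; no)
open import Relation.Binary using (Rel; IsEquivalence; DecidableEquality)
open import Relation.Binary.PropositionalEquality using (_≡_; _≢_)
open import Algebra.Structures using (IsAbelianGroup)

record Subring : Set₁ where
  field
    _∈R  : ℚ → Set
    0∈   : 0ℚ ∈R
    1∈   : 1ℚ ∈R
    +∈   : ∀ {a b} → a ∈R → b ∈R → (a ℚ.+ b) ∈R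
    -∈   : ∀ {a} → a ∈R → (ℚ.- a) ∈R
    *∈   : ∀ {a b} → a ∈R → b ∈R → (a ℚ.* b) ∈R

  Scalar : Set
  Scalar = Σ ℚ _∈R

  _+ˢ_ : Scalar → Scalar → Scalar
  (a , p) +ˢ (b , q) = a ℚ.+ b , +∈ p q

  _*ˢ_ : Scalar → Scalar → Scalar
  (a , p) *ˢ (b , q) = a ℚ.* b , *∈ p q

  -ˢ_ : Scalar → Scalar
  -ˢ (a , p) = ℚ.- a , -∈ p

  1ˢ : Scalar
  1ˢ = 1ℚ , 1∈

  0ˢ : Scalar
  0ˢ = 0ℚ , 0∈

  _∣R_ : Scalar → Scalar → Set
  a ∣R b = Σ Scalar λ r → proj₁ b ≡ proj₁ a ℚ.* proj₁ r

open Subring public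

record RawModule (R : Subring) : Set₁ where
  infixl 6 _+_
  infixl 7 _·_
  infix 4 _≈_
  field
    Carrier : Set
    _≈_     : Rel Carrier 0ℓ
    _+_     : Carrier → Carrier → Carrier
    0#      : Carrier
    -_      : Carrier → Carrier
    _·_     : Carrier → Scalar R → Carrier

record IsModule (S : Subring) {C : Set} (_≈_ : Rel C 0ℓ) (_+_ : C → C → C)
                (0# : C) (-_ : C → C) (_·_ : C → Scalar S → C) : Set where
  field
    isAbelianGroup : IsAbelianGroup _≈_ _+_ 0# -_
    ·-cong   : ∀ {x y} {r s : Scalar S} → x ≈ y → proj₁ r ≡ proj₁ s → (x · r) ≈ (y · s)
    ·-distribˡ : ∀ x y r → ((x + y) · r) ≈ ((x · r) + (y · r))
    ·-distribʳ : ∀ x r s → (x · (_+ˢ_ S r s)) ≈ ((x · r) + (x · s))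
    ·-assoc  : ∀ x r s → (x · (_*ˢ_ S r s)) ≈ ((x · r) · s)
    ·-identity : ∀ x → (x · 1ˢ S) ≈ x

record Module (R : Subring) : Set₁ where
  field
    raw : RawModule R
  open RawModule raw public
  field
    isModule : IsModule R _≈_ _+_ 0# -_ _·_

open Module public using (raw)

record Hom {R : Subring} (A B : RawModule R) : Set where
  private
    module A = RawModule A
    module B = RawModule B
  field
    ⟦_⟧    : A.Carrier → B.Carrier
    cong   : ∀ {x y} → x A.≈ y → ⟦ x ⟧ B.≈ ⟦ y ⟧
    hom-+  : ∀ x y → ⟦ x A.+ y ⟧ B.≈ (⟦ x ⟧ B.+ ⟦ y ⟧)
    hom-·  : ∀ x r → ⟦ x A.· r ⟧ B.≈ (⟦ x ⟧ B.· r)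

open Hom public

record Iso {R : Subring} (A B : RawModule R) : Set where
  private
    module A = RawModule A
    module B = RawModule B
  field
    to   : Hom A B
    from : Hom B A
    to∘from : ∀ y → ⟦ to ⟧ (⟦ from ⟧ y) B.≈ y
    from∘to : ∀ x → ⟦ from ⟧ (⟦ to ⟧ x) A.≈ x

RasModule : (R : Subring) → RawModule R
RasModule R = record
  { Carrier = Scalar R
  ; _≈_ = λ a b → proj₁ a ≡ proj₁ b
  ; _+_ = _+ˢ_ R
  ; 0# = 0ˢ R
  ; -_ = -ˢ_ R
  ; _·_ = _*ˢ_ R
  }

TorsionFree : {R : Subring} → Module R → Set
TorsionFree {R} G = ∀ (x : Carrier) (r : Scalar R) → proj₁ r ≢ 0ℚ → (x · r) ≈ 0# → x ≈ 0#
  where open Module G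

-- "the nucleus of G is R": R ⊆ nucleus holds since G is an R-module; and
-- every subring S such that the underlying abelian group of G admits an
-- S-module structure is contained in R.
NucleusIs : (R : Subring) → Module R → Set₁
NucleusIs R G =
  ∀ (S : Subring) (act : Carrier → Scalar S → Carrier) →
    IsModule S _≈_ _+_ 0# -_ act → ∀ q → _∈R S q → _∈R R q
  where open Module G

data ℕω : Set where
  fin   : ℕ → ℕω
  omega : ℕω

Idx : ℕω → Set
Idx (fin n) = Fin n
Idx omega   = ℕ

_≟Idx_ : {n : ℕω} → DecidableEquality (Idx n)
_≟Idx_ {fin n} = Fin._≟_
_≟Idx_ {omega} = ℕ._≟_

FinSupport : (n : ℕω) → (Idx n → ℕ → ℚ) → Set
FinSupport (fin n) k = ⊤
FinSupport omega   k = ∀ m → Σ ℕ λ b → ∀ i → b ≤ i → k i m ≡ 0ℚ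

supportList : (n : ℕω) (k : Idx n → ℕ → ℚ) → FinSupport n k → ℕ → List (Idx n)
supportList (fin n) k s m = allFin n
supportList omega   k s m = upTo (proj₁ (s m))

record FreeBy1Data (R : Subring) (n : ℕω) : Set where
  field
    p      : ℕ → Scalar R
    k      : Idx n → ℕ → Scalar R
    p≢0    : ∀ m → proj₁ (p m) ≢ 0ℚ
    chain  : ∀ j m → j ≤ m → _∣R_ R (p j) (p m)
    finSupp : FinSupport n (λ i m → proj₁ (k i m))

  supp : ℕ → List (Idx n)
  supp = supportList n (λ i m → proj₁ (k i m)) finSupp

open FreeBy1Data public

-- The module G' = B / N

data Gen (n : ℕω) : Set where
  X : Idx n → Gen n
  Y : ℕ → Gen n

sumℚ : List ℚ → ℚ
sumℚ = foldr ℚ._+_ 0ℚ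

module _ {R : Subring} {n : ℕω} (D : FreeBy1Data R n) where

  -- elements of the free module B, as finite formal R-linear combinations
  BElt : Set
  BElt = List (Gen n × Scalar R)

  eqGen : Gen n → Gen n → ℚ → ℚ
  eqGen (X i) (X j) q with i ≟Idx j
  ... | yes _ = q
  ... | no  _ = 0ℚ
  eqGen (Y i) (Y j) q with i ℕ.≟ j
  ... | yes _ = q
  ... | no  _ = 0ℚ
  eqGen _ _ q = 0ℚ

  coeff : BElt → Gen n → ℚ
  coeff b g = sumℚ (map (λ gs → eqGen (proj₁ gs) g (proj₁ (proj₂ gs))) b)

  -- coefficient of a generator in the relator  y_{m+1} p_m - y_m - Σ x_i k_{im}
  relCoeff : ℕ → Gen n → ℚ
  relCoeff m (X i) = ℚ.- proj₁ (k D i m)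
  relCoeff m (Y j) with j ℕ.≟ suc m | j ℕ.≟ m
  ... | yes _ | _     = proj₁ (p D m)
  ... | no _  | yes _ = ℚ.- 1ℚ
  ... | no _  | no _  = 0ℚ

  InN : (Gen n → ℚ) → Set
  InN d = Σ (List (ℕ × Scalar R)) λ L →
            ∀ g → d g ≡ sumℚ (map (λ mr → proj₁ (proj₂ mr) ℚ.* relCoeff (proj₁ mr) g) L)

  G′ : RawModule R
  G′ = record
    { Carrier = BElt
    ; _≈_ = λ a b → InN (λ g → coeff a g ℚ.- coeff b g)
    ; _+_ = _++_
    ; 0# = []
    ; -_ = map (λ gs → proj₁ gs , -ˢ_ R (proj₂ gs))
    ; _·_ = λ b r → map (λ gs → proj₁ gs , _*ˢ_ R (proj₂ gs) r) b
    }

-- the data of the rank-one quotient  G' / ⊕ x'_i R  (the 0-free-by-1 module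
-- with the same p_m)
rankOneData : {R : Subring} {n : ℕω} → FreeBy1Data R n → FreeBy1Data R (fin 0)
rankOneData D = record
  { p = p D
  ; k = λ ()
  ; p≢0 = p≢0 D
  ; chain = chain D
  ; finSupp = _
  }

-- G' is not free: G'/⊕ x'_i R is not isomorphic to R
NotFree : {R : Subring} {n : ℕω} → FreeBy1Data R n → Set
NotFree {R} D = ¬ Iso (G′ (rankOneData D)) (RasModule R)

-- Ext(A, G) = 0 : every extension  0 → G → E → A → 0  of R-modules splits

ExtSplits : {R : Subring} (A : RawModule R) (G E : Module R) → Set
ExtSplits {R} A G E =
  ∀ (f : Hom (raw G) (raw E)) (g : Hom (raw E) A) →
    (∀ x y → ⟦ f ⟧ x E.≈ ⟦ f ⟧ y → x G.≈ y) →
    (∀ a → Σ (E.Carrier) λ e → ⟦ g ⟧ e A.≈ a) →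
    (∀ e → ⟦ g ⟧ e A.≈ A.0# → Σ (G.Carrier) λ x → ⟦ f ⟧ x E.≈ e) →
    (∀ x → ⟦ g ⟧ (⟦ f ⟧ x) A.≈ A.0#) →
    Σ (Hom A (raw E)) λ s → ∀ a → ⟦ g ⟧ (⟦ s ⟧ a) A.≈ a
  where
    module A = RawModule A
    module G = Module G
    module E = Module E

Ext0 : {R : Subring} → RawModule R → Module R → Set₁
Ext0 {R} A G = ∀ (E : Module R) → ExtSplits A G E

sumM : {R : Subring} (G : Module R) → List (Module.Carrier G) → Module.Carrier G
sumM G = foldr (Module._+_ G) (Module.0# G)

Complete : {R : Subring} {n : ℕω} → FreeBy1Data R n → Module R → Set
Complete {R} {n} D G =
  ∀ (c : ℕ → Carrier) →
    Σ (ℕ → Carrier) λ y → Σ (Idx n → Carrier) λ x →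
      ∀ m → (y (suc m) · p D m) ≈
            ((y m + sumM G (map (λ i → x i · k D i m) (supp D m))) + c m)
  where open Module G

-- G′ = B/N, and N is free on the relators ρ_m = y_{m+1} p_m − y_m − Σ_i x_i k_{im}: the coefficients of a
-- combination of relators at y₀, y₁, … recover its coefficients one at a time.  Hence homomorphisms N → G
-- are arbitrary sequences (c_m), and Ext(G′, G) = 0 says exactly that each of them extends to B, i.e. that
-- the system y_{m+1} p_m = y_m + Σ_i x_i k_{im} + c_m is solvable.  Concretely, a splitting of the pushout
-- of B ← N → G is read off as a solution; conversely, in any extension E the relators evaluated on lifts
-- of the generators land in G, and a solution for their negatives corrects the lifts into a section.
module Submission where

open import Defs
open import Data.Product using (_×_)

open import Level using (0ℓ)
open import Data.Rational as ℚ using (ℚ; 0ℚ; 1ℚ)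
import Data.Rational.Properties as ℚP
open import Data.Rational.Solver using (module +-*-Solver)
open import Data.Nat as ℕ using (ℕ; zero; suc; z≤n; s≤s)
import Data.Nat.Properties as ℕP
open import Data.Fin as Fin using (Fin)
import Data.Fin.Properties as FinP
open import Data.List using (List; []; _∷_; _++_; map; foldr; length; tabulate; allFin; upTo; [_])
import Data.List.Properties as LP
open import Data.Product using (Σ; _,_; proj₁; proj₂)
open import Data.Sum using (_⊎_; inj₁; inj₂)
open import Data.Empty using (⊥-elim)
open import Relation.Nullary using (yes; no; Dec)
open import Relation.Binary using (DecidableEquality)
import Relation.Binary.PropositionalEquality as P
open P using (_≡_; _≢_)
open import Algebra.Bundles using (AbelianGroup)
open import Algebra.Structures using (IsAbelianGroup)
import Algebra.Properties.AbelianGroup as AbelianGroupProperties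
import Algebra.Properties.CommutativeSemigroup as CommutativeSemigroupProperties
import Relation.Binary.Reasoning.Setoid as SetoidReasoning

open +-*-Solver using (solve; _:+_; _:*_; _:-_; :-_; con; _:=_)

module ModuleProperties {R : Subring} (M : Module R) where
  open Module M public using (Carrier; _≈_; _+_; 0#; -_; _·_)
  open IsModule (Module.isModule M) public
  open IsAbelianGroup isAbelianGroup public
    using (refl; sym; trans; assoc; comm; identityˡ; identityʳ; inverseˡ; inverseʳ;
           ⁻¹-cong; ∙-cong; ∙-congˡ; ∙-congʳ; setoid)

  abelianGroup : AbelianGroup 0ℓ 0ℓ
  abelianGroup = record { isAbelianGroup = isAbelianGroup }

  open AbelianGroupProperties abelianGroup public
    using (identityʳ-unique; inverseʳ-unique; ε⁻¹≈ε; x∙y⁻¹≈ε⇒x≈y; ⁻¹-∙-comm)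
  open CommutativeSemigroupProperties (AbelianGroup.commutativeSemigroup abelianGroup) public
    using (interchange)
  open SetoidReasoning setoid

  x∙y⁻¹≈z⇒x≈z∙y : ∀ x y z → (x + (- y)) ≈ z → x ≈ (z + y)
  x∙y⁻¹≈z⇒x≈z∙y x y z p = begin
    x                 ≈⟨ sym (identityʳ x) ⟩
    x + 0#            ≈⟨ ∙-congˡ (sym (inverseˡ y)) ⟩
    x + ((- y) + y)   ≈⟨ sym (assoc x (- y) y) ⟩
    (x + (- y)) + y   ≈⟨ ∙-congʳ p ⟩
    z + y             ∎

  x≈z∙y⇒x∙y⁻¹≈z : ∀ x y z → x ≈ (z + y) → (x + (- y)) ≈ z
  x≈z∙y⇒x∙y⁻¹≈z x y z p = begin
    x + (- y)         ≈⟨ ∙-congʳ p ⟩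
    (z + y) + (- y)   ≈⟨ assoc z y (- y) ⟩
    z + (y + (- y))   ≈⟨ ∙-congˡ (inverseʳ y) ⟩
    z + 0#            ≈⟨ identityʳ z ⟩
    z                 ∎

  ·-cong₁ : ∀ {x y} (r : Scalar R) → x ≈ y → (x · r) ≈ (y · r)
  ·-cong₁ r p = ·-cong p P.refl

  ·-cong₂ : ∀ x {r s : Scalar R} → proj₁ r ≡ proj₁ s → (x · r) ≈ (x · s)
  ·-cong₂ x e = ·-cong refl e

  ·-zeroʳ : ∀ x (s : Scalar R) → proj₁ s ≡ 0ℚ → (x · s) ≈ 0#
  ·-zeroʳ x s s≡0 = identityʳ-unique (x · s) (x · s) (begin
    (x · s) + (x · s)      ≈⟨ sym (·-distribʳ x s s) ⟩
    x · (_+ˢ_ R s s)       ≈⟨ ·-cong₂ x (P.trans (P.cong₂ ℚ._+_ s≡0 s≡0) (P.sym s≡0)) ⟩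
    x · s                  ∎)

  ·-zeroˡ : ∀ r → (0# · r) ≈ 0#
  ·-zeroˡ r = identityʳ-unique (0# · r) (0# · r) (begin
    (0# · r) + (0# · r)  ≈⟨ sym (·-distribˡ 0# 0# r) ⟩
    (0# + 0#) · r        ≈⟨ ·-cong₁ r (identityˡ 0#) ⟩
    0# · r               ∎)

  ·-negʳ : ∀ x r → (x · (-ˢ_ R r)) ≈ (- (x · r))
  ·-negʳ x r = inverseʳ-unique (x · r) (x · (-ˢ_ R r)) (begin
    (x · r) + (x · (-ˢ_ R r))  ≈⟨ sym (·-distribʳ x r (-ˢ_ R r)) ⟩
    x · (_+ˢ_ R r (-ˢ_ R r))   ≈⟨ ·-zeroʳ x _ (ℚP.+-inverseʳ (proj₁ r)) ⟩
    0#                         ∎)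

  ∑ : {A : Set} → (A → Carrier) → List A → Carrier
  ∑ f l = foldr _+_ 0# (map f l)

  ∑-++ : {A : Set} (f : A → Carrier) (l₁ l₂ : List A) → ∑ f (l₁ ++ l₂) ≈ (∑ f l₁ + ∑ f l₂)
  ∑-++ f [] l₂ = sym (identityˡ _)
  ∑-++ f (a ∷ l₁) l₂ = trans (∙-congˡ (∑-++ f l₁ l₂)) (sym (assoc _ _ _))

  ∑-cong : {A : Set} {f g : A → Carrier} (l : List A) → (∀ a → f a ≈ g a) → ∑ f l ≈ ∑ g l
  ∑-cong [] e = refl
  ∑-cong (a ∷ l) e = ∙-cong (e a) (∑-cong l e)

  ∑-neg : {A : Set} (f : A → Carrier) (l : List A) → ∑ (λ a → - (f a)) l ≈ (- ∑ f l)
  ∑-neg f [] = sym ε⁻¹≈ε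
  ∑-neg f (a ∷ l) = trans (∙-congˡ (∑-neg f l)) (⁻¹-∙-comm _ _)

  ∑-· : {A : Set} (f : A → Carrier) (r : Scalar R) (l : List A) → ∑ (λ a → f a · r) l ≈ (∑ f l · r)
  ∑-· f r [] = sym (·-zeroˡ r)
  ∑-· f r (a ∷ l) = trans (∙-congˡ (∑-· f r l)) (sym (·-distribˡ _ _ r))

  ∑-map : {A B : Set} (f : B → Carrier) (h : A → B) (l : List A) → ∑ f (map h l) ≈ ∑ (λ a → f (h a)) l
  ∑-map f h [] = refl
  ∑-map f h (a ∷ l) = ∙-congˡ (∑-map f h l)

module VanishingCombination {R : Subring} (M : Module R) {K : Set} (_≟K_ : DecidableEquality K)
    (sel : K → K → ℚ → ℚ) (sel-diag : ∀ k q → sel k k q ≡ q)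
    (sel-offdiag : ∀ k k′ q → k ≢ k′ → sel k k′ q ≡ 0ℚ) (v : K → Module.Carrier M) where
  open ModuleProperties M
  open SetoidReasoning setoid

  term : K × Scalar R → Carrier
  term (k , r) = v k · r

  weight : List (K × Scalar R) → K → ℚ
  weight l k = sumℚ (map (λ kr → sel (proj₁ kr) k (proj₁ (proj₂ kr))) l)

  atKey : K → List (K × Scalar R) → List (K × Scalar R)
  atKey k₀ [] = []
  atKey k₀ ((k , r) ∷ l) with k ≟K k₀
  ... | yes _ = (k , r) ∷ atKey k₀ l
  ... | no _  = atKey k₀ l

  offKey : K → List (K × Scalar R) → List (K × Scalar R)
  offKey k₀ [] = []
  offKey k₀ ((k , r) ∷ l) with k ≟K k₀
  ... | yes _ = offKey k₀ l
  ... | no _  = (k , r) ∷ offKey k₀ l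

  ∑-atKey-offKey : ∀ k₀ l → ∑ term l ≈ (∑ term (atKey k₀ l) + ∑ term (offKey k₀ l))
  ∑-atKey-offKey k₀ [] = sym (identityˡ 0#)
  ∑-atKey-offKey k₀ ((k , r) ∷ l) with k ≟K k₀
  ... | yes _ = trans (∙-congˡ (∑-atKey-offKey k₀ l)) (sym (assoc _ _ _))
  ... | no _  = begin
      a + ∑ term l   ≈⟨ ∙-congˡ (∑-atKey-offKey k₀ l) ⟩
      a + (b + c)    ≈⟨ sym (assoc a b c) ⟩
      (a + b) + c    ≈⟨ ∙-congʳ (comm a b) ⟩
      (b + a) + c    ≈⟨ assoc b a c ⟩
      b + (a + c)    ∎
    where a = term (k , r)
          b = ∑ term (atKey k₀ l)
          c = ∑ term (offKey k₀ l)

  ∑-atKey : ∀ k₀ l → Σ (Scalar R) λ σ → (proj₁ σ ≡ weight l k₀) × (∑ term (atKey k₀ l) ≈ (v k₀ · σ))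
  ∑-atKey k₀ [] = 0ˢ R , P.refl , sym (·-zeroʳ (v k₀) (0ˢ R) P.refl)
  ∑-atKey k₀ ((k , r) ∷ l) with k ≟K k₀ | ∑-atKey k₀ l
  ... | yes P.refl | σ , σ≡ , ∑≈ =
    _+ˢ_ R r σ , P.cong₂ ℚ._+_ (P.sym (sel-diag k (proj₁ r))) σ≡ ,
    trans (∙-congˡ ∑≈) (sym (·-distribʳ (v k) r σ))
  ... | no k≢k₀ | σ , σ≡ , ∑≈ =
    σ , P.trans σ≡ (P.sym (P.trans (P.cong (ℚ._+ weight l k₀) (sel-offdiag k k₀ (proj₁ r) k≢k₀))
                                   (ℚP.+-identityˡ _))) , ∑≈

  weight-offKey-other : ∀ k₀ k l → k ≢ k₀ → weight (offKey k₀ l) k ≡ weight l k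
  weight-offKey-other k₀ k [] _ = P.refl
  weight-offKey-other k₀ k ((k′ , r) ∷ l) k≢k₀ with k′ ≟K k₀
  ... | yes P.refl = P.trans (weight-offKey-other k₀ k l k≢k₀)
          (P.sym (P.trans (P.cong (ℚ._+ weight l k) (sel-offdiag k′ k (proj₁ r) (λ e → k≢k₀ (P.sym e))))
                          (ℚP.+-identityˡ _)))
  ... | no _ = P.cong (sel k′ k (proj₁ r) ℚ.+_) (weight-offKey-other k₀ k l k≢k₀)

  weight-offKey-self : ∀ k₀ l → weight (offKey k₀ l) k₀ ≡ 0ℚ
  weight-offKey-self k₀ [] = P.refl
  weight-offKey-self k₀ ((k , r) ∷ l) with k ≟K k₀
  ... | yes _ = weight-offKey-self k₀ l
  ... | no k≢k₀ = P.trans (P.cong₂ ℚ._+_ (sel-offdiag k k₀ (proj₁ r) k≢k₀) (weight-offKey-self k₀ l))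
                          (ℚP.+-identityˡ 0ℚ)

  length-offKey : ∀ k₀ l → length (offKey k₀ l) ℕ.≤ length l
  length-offKey k₀ [] = z≤n
  length-offKey k₀ ((k , r) ∷ l) with k ≟K k₀
  ... | yes _ = ℕP.m≤n⇒m≤1+n (length-offKey k₀ l)
  ... | no _  = s≤s (length-offKey k₀ l)

  offKey-head : ∀ k₀ r l → offKey k₀ ((k₀ , r) ∷ l) ≡ offKey k₀ l
  offKey-head k₀ r l with k₀ ≟K k₀
  ... | yes _ = P.refl
  ... | no k₀≢k₀ = ⊥-elim (k₀≢k₀ P.refl)

  -- Induction on the length: the terms at the head's key sum to v k₀ · 0, the rest is shorter.
  ∑-weightless : ∀ l → (∀ k → weight l k ≡ 0ℚ) → ∑ term l ≈ 0#
  ∑-weightless l = go (length l) l ℕP.≤-refl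
    where
      go : ∀ bound l → length l ℕ.≤ bound → (∀ k → weight l k ≡ 0ℚ) → ∑ term l ≈ 0#
      go _ [] _ _ = refl
      go zero (_ ∷ _) () _
      go (suc bound) l@((k₀ , r) ∷ l′) (s≤s len) weightless = begin
          ∑ term l                                         ≈⟨ ∑-atKey-offKey k₀ l ⟩
          ∑ term (atKey k₀ l) + ∑ term (offKey k₀ l)       ≈⟨ ∙-cong atKey≈0 offKey≈0 ⟩
          0# + 0#                                          ≈⟨ identityˡ 0# ⟩
          0#                                               ∎
        where
          σ = ∑-atKey k₀ l
          atKey≈0 : ∑ term (atKey k₀ l) ≈ 0#
          atKey≈0 = trans (proj₂ (proj₂ σ))
                          (·-zeroʳ (v k₀) (proj₁ σ) (P.trans (proj₁ (proj₂ σ)) (weightless k₀)))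
          shorter : length (offKey k₀ l) ℕ.≤ bound
          shorter = ℕP.≤-trans (ℕP.≤-reflexive (P.cong length (offKey-head k₀ r l′)))
                               (ℕP.≤-trans (length-offKey k₀ l′) len)
          offKey-weightless : ∀ k → weight (offKey k₀ l) k ≡ 0ℚ
          offKey-weightless k with k ≟K k₀
          ... | yes P.refl = weight-offKey-self k₀ l
          ... | no k≢k₀ = P.trans (weight-offKey-other k₀ k l k≢k₀) (weightless k)
          offKey≈0 : ∑ term (offKey k₀ l) ≈ 0#
          offKey≈0 = go bound (offKey k₀ l) shorter offKey-weightless

sumℚ-++ : ∀ (l₁ l₂ : List ℚ) → sumℚ (l₁ ++ l₂) ≡ sumℚ l₁ ℚ.+ sumℚ l₂
sumℚ-++ [] l₂ = P.sym (ℚP.+-identityˡ _)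
sumℚ-++ (x ∷ l₁) l₂ = P.trans (P.cong (x ℚ.+_) (sumℚ-++ l₁ l₂)) (P.sym (ℚP.+-assoc x _ _))

sumℚ-zero : ∀ {A : Set} (f : A → ℚ) (l : List A) → (∀ a → f a ≡ 0ℚ) → sumℚ (map f l) ≡ 0ℚ
sumℚ-zero f [] _ = P.refl
sumℚ-zero f (a ∷ l) f≡0 = P.cong₂ ℚ._+_ (f≡0 a) (sumℚ-zero f l f≡0)

sumℚ-neg : ∀ {A : Set} (f : A → ℚ) (l : List A) → sumℚ (map (λ a → ℚ.- f a) l) ≡ ℚ.- sumℚ (map f l)
sumℚ-neg f [] = P.refl
sumℚ-neg f (a ∷ l) = P.trans (P.cong (ℚ.- f a ℚ.+_) (sumℚ-neg f l)) (P.sym (ℚP.neg-distrib-+ (f a) _))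

sumℚ-*ʳ : ∀ {A : Set} (f : A → ℚ) (s : ℚ) (l : List A) →
          sumℚ (map (λ a → f a ℚ.* s) l) ≡ sumℚ (map f l) ℚ.* s
sumℚ-*ʳ f s [] = P.sym (ℚP.*-zeroˡ s)
sumℚ-*ʳ f s (a ∷ l) = P.trans (P.cong (f a ℚ.* s ℚ.+_) (sumℚ-*ʳ f s l)) (P.sym (ℚP.*-distribʳ-+ s (f a) _))

sumℚ-cong : ∀ {A : Set} {f g : A → ℚ} (l : List A) → (∀ a → f a ≡ g a) → sumℚ (map f l) ≡ sumℚ (map g l)
sumℚ-cong l e = P.cong sumℚ (LP.map-cong e l)

δ : {A : Set} → DecidableEquality A → A → A → ℚ → ℚ
δ _≟_ a b q with a ≟ b
... | yes _ = q
... | no _  = 0ℚ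

δ-diag : {A : Set} (_≟_ : DecidableEquality A) → ∀ a q → δ _≟_ a a q ≡ q
δ-diag _≟_ a q with a ≟ a
... | yes _ = P.refl
... | no a≢a = ⊥-elim (a≢a P.refl)

δ-offdiag : {A : Set} (_≟_ : DecidableEquality A) → ∀ a b q → a ≢ b → δ _≟_ a b q ≡ 0ℚ
δ-offdiag _≟_ a b q a≢b with a ≟ b
... | yes a≡b = ⊥-elim (a≢b a≡b)
... | no _    = P.refl

δFin-suc : ∀ {N} (i j : Fin N) q → δ Fin._≟_ (Fin.suc i) (Fin.suc j) q ≡ δ Fin._≟_ i j q
δFin-suc i j q = cases (i Fin.≟ j)
  where
    cases : Dec (i ≡ j) → δ Fin._≟_ (Fin.suc i) (Fin.suc j) q ≡ δ Fin._≟_ i j q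
    cases (yes P.refl) = P.trans (δ-diag Fin._≟_ (Fin.suc i) q) (P.sym (δ-diag Fin._≟_ i q))
    cases (no i≢j) = P.trans (δ-offdiag Fin._≟_ (Fin.suc i) (Fin.suc j) q (λ e → i≢j (FinP.suc-injective e)))
                             (P.sym (δ-offdiag Fin._≟_ i j q i≢j))

sumℚ-tabulate-δ : ∀ N (F : Fin N → ℚ) (j : Fin N) → sumℚ (tabulate (λ i → δ Fin._≟_ i j (F i))) ≡ F j
sumℚ-tabulate-δ (suc N) F Fin.zero =
  P.trans (P.cong₂ ℚ._+_ (δ-diag (Fin._≟_ {suc N}) Fin.zero (F Fin.zero)) rest) (ℚP.+-identityʳ _)
  where
    rest : sumℚ (tabulate (λ i → δ Fin._≟_ (Fin.suc i) Fin.zero (F (Fin.suc i)))) ≡ 0ℚ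
    δF = λ i → δ Fin._≟_ (Fin.suc i) Fin.zero (F (Fin.suc i))
    rest = P.trans (P.cong sumℚ (P.sym (LP.map-tabulate (λ i → i) δF)))
                   (sumℚ-zero δF (tabulate {n = N} (λ i → i))
                      (λ i → δ-offdiag (Fin._≟_ {suc N}) (Fin.suc i) Fin.zero (F (Fin.suc i)) (λ ())))
sumℚ-tabulate-δ (suc N) F (Fin.suc j) =
  P.trans (P.cong₂ ℚ._+_ (δ-offdiag (Fin._≟_ {suc N}) Fin.zero (Fin.suc j) (F Fin.zero) (λ ())) rest)
          (ℚP.+-identityˡ _)
  where
    rest : sumℚ (tabulate (λ i → δ Fin._≟_ (Fin.suc i) (Fin.suc j) (F (Fin.suc i)))) ≡ F (Fin.suc j)
    rest = P.trans (P.cong sumℚ (LP.tabulate-cong (λ i → δFin-suc i j (F (Fin.suc i)))))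
                   (sumℚ-tabulate-δ N (λ i → F (Fin.suc i)) j)

sumℚ-allFin-δ : ∀ N (F : Fin N → ℚ) (j : Fin N) → sumℚ (map (λ i → δ Fin._≟_ i j (F i)) (allFin N)) ≡ F j
sumℚ-allFin-δ N F j =
  P.trans (P.cong sumℚ (LP.map-tabulate (λ i → i) (λ i → δ Fin._≟_ i j (F i)))) (sumℚ-tabulate-δ N F j)

map-upTo-suc : ∀ {A : Set} (h : ℕ → A) b → map h (upTo (suc b)) ≡ map h (upTo b) ++ [ h b ]
map-upTo-suc h b = P.trans (P.cong (map h) (P.sym (LP.upTo-∷ʳ b))) (LP.map-++ h (upTo b) [ b ])

sumℚ-upTo-δ-≥ : ∀ (F : ℕ → ℚ) b j → b ℕ.≤ j → sumℚ (map (λ i → δ ℕ._≟_ i j (F i)) (upTo b)) ≡ 0ℚ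
sumℚ-upTo-δ-≥ F zero j _ = P.refl
sumℚ-upTo-δ-≥ F (suc b) j b<j = begin
  sumℚ (map δF (upTo (suc b)))             ≡⟨ P.cong sumℚ (map-upTo-suc δF b) ⟩
  sumℚ (map δF (upTo b) ++ [ δF b ])       ≡⟨ sumℚ-++ (map δF (upTo b)) _ ⟩
  sumℚ (map δF (upTo b)) ℚ.+ (δF b ℚ.+ 0ℚ) ≡⟨ P.cong₂ ℚ._+_ (sumℚ-upTo-δ-≥ F b j (ℕP.<⇒≤ b<j))
                                                (P.cong (ℚ._+ 0ℚ) (δ-offdiag ℕ._≟_ b j (F b) (ℕP.<⇒≢ b<j))) ⟩
  0ℚ                                       ∎
  where
    open P.≡-Reasoning
    δF = λ i → δ ℕ._≟_ i j (F i)

sumℚ-upTo-δ-< : ∀ (F : ℕ → ℚ) b j → j ℕ.< b → sumℚ (map (λ i → δ ℕ._≟_ i j (F i)) (upTo b)) ≡ F j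
sumℚ-upTo-δ-< F (suc b) j j<1+b =
  P.trans (P.cong sumℚ (map-upTo-suc δF b))
          (P.trans (sumℚ-++ (map δF (upTo b)) _) (last (ℕP.m≤n⇒m<n∨m≡n (ℕP.≤-pred j<1+b))))
  where
    δF = λ i → δ ℕ._≟_ i j (F i)
    last : j ℕ.< b ⊎ j ≡ b → sumℚ (map δF (upTo b)) ℚ.+ (δF b ℚ.+ 0ℚ) ≡ F j
    last (inj₁ j<b) =
      P.trans (P.cong₂ ℚ._+_ (sumℚ-upTo-δ-< F b j j<b)
                            (P.cong (ℚ._+ 0ℚ) (δ-offdiag ℕ._≟_ b j (F b) (ℕP.>⇒≢ j<b))))
              (ℚP.+-identityʳ (F j))
    last (inj₂ P.refl) =
      P.trans (P.cong₂ ℚ._+_ (sumℚ-upTo-δ-≥ F j j ℕP.≤-refl)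
                            (P.trans (P.cong (ℚ._+ 0ℚ) (δ-diag ℕ._≟_ j (F j))) (ℚP.+-identityʳ (F j))))
              (ℚP.+-identityˡ (F j))

sumℚ-supp-δ : ∀ {R : Subring} n (D : FreeBy1Data R n) m j →
              sumℚ (map (λ i → δ (_≟Idx_ {n}) i j (proj₁ (k D i m))) (supp D m)) ≡ proj₁ (k D j m)
sumℚ-supp-δ (fin N) D m j = sumℚ-allFin-δ N (λ i → proj₁ (k D i m)) j
sumℚ-supp-δ omega D m j with j ℕ.<? proj₁ (finSupp D m)
... | yes j<b = sumℚ-upTo-δ-< (λ i → proj₁ (k D i m)) _ j j<b
... | no j≮b = P.trans (sumℚ-upTo-δ-≥ (λ i → proj₁ (k D i m)) _ j (ℕP.≮⇒≥ j≮b))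
                       (P.sym (proj₂ (finSupp D m) j (ℕP.≮⇒≥ j≮b)))

module Presentation {R : Subring} {n : ℕω} (D : FreeBy1Data R n) where

  cf : BElt D → Gen n → ℚ
  cf = coeff D

  X-injective : ∀ {i j : Idx n} → X i ≡ X j → i ≡ j
  X-injective P.refl = P.refl

  Y-injective : ∀ {i j} → Y {n} i ≡ Y j → i ≡ j
  Y-injective P.refl = P.refl

  _≟Gen_ : DecidableEquality (Gen n)
  X i ≟Gen X j with _≟Idx_ {n} i j
  ... | yes P.refl = yes P.refl
  ... | no i≢j     = no (λ e → i≢j (X-injective e))
  Y i ≟Gen Y j with i ℕ.≟ j
  ... | yes P.refl = yes P.refl
  ... | no i≢j     = no (λ e → i≢j (Y-injective e))
  X _ ≟Gen Y _ = no (λ ())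
  Y _ ≟Gen X _ = no (λ ())

  eqGen-diag : ∀ g q → eqGen D g g q ≡ q
  eqGen-diag (X i) q with _≟Idx_ {n} i i
  ... | yes _ = P.refl
  ... | no i≢i = ⊥-elim (i≢i P.refl)
  eqGen-diag (Y i) q with i ℕ.≟ i
  ... | yes _ = P.refl
  ... | no i≢i = ⊥-elim (i≢i P.refl)

  eqGen-offdiag : ∀ g g′ q → g ≢ g′ → eqGen D g g′ q ≡ 0ℚ
  eqGen-offdiag (X i) (X j) q g≢g′ with _≟Idx_ {n} i j
  ... | yes P.refl = ⊥-elim (g≢g′ P.refl)
  ... | no _ = P.refl
  eqGen-offdiag (Y i) (Y j) q g≢g′ with i ℕ.≟ j
  ... | yes P.refl = ⊥-elim (g≢g′ P.refl)
  ... | no _ = P.refl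
  eqGen-offdiag (X i) (Y j) q _ = P.refl
  eqGen-offdiag (Y i) (X j) q _ = P.refl

  eqGen-neg : ∀ g g′ q → eqGen D g g′ (ℚ.- q) ≡ ℚ.- eqGen D g g′ q
  eqGen-neg g g′ q = cases (g ≟Gen g′)
    where
      cases : Dec (g ≡ g′) → eqGen D g g′ (ℚ.- q) ≡ ℚ.- eqGen D g g′ q
      cases (yes P.refl) = P.trans (eqGen-diag g (ℚ.- q)) (P.cong ℚ.-_ (P.sym (eqGen-diag g q)))
      cases (no g≢g′) = P.trans (eqGen-offdiag g g′ (ℚ.- q) g≢g′) (P.cong ℚ.-_ (P.sym (eqGen-offdiag g g′ q g≢g′)))

  eqGen-*ʳ : ∀ g g′ q r → eqGen D g g′ (q ℚ.* r) ≡ eqGen D g g′ q ℚ.* r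
  eqGen-*ʳ g g′ q r = cases (g ≟Gen g′)
    where
      cases : Dec (g ≡ g′) → eqGen D g g′ (q ℚ.* r) ≡ eqGen D g g′ q ℚ.* r
      cases (yes P.refl) = P.trans (eqGen-diag g (q ℚ.* r)) (P.cong (ℚ._* r) (P.sym (eqGen-diag g q)))
      cases (no g≢g′) = P.trans (eqGen-offdiag g g′ _ g≢g′)
                          (P.trans (P.sym (ℚP.*-zeroˡ r)) (P.cong (ℚ._* r) (P.sym (eqGen-offdiag g g′ q g≢g′))))

  eqGen-X-δ : ∀ i j q → eqGen D (X i) (X j) q ≡ δ (_≟Idx_ {n}) i j q
  eqGen-X-δ i j q = cases (_≟Idx_ {n} i j)
    where
      cases : Dec (i ≡ j) → eqGen D (X i) (X j) q ≡ δ (_≟Idx_ {n}) i j q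
      cases (yes P.refl) = P.trans (eqGen-diag (X i) q) (P.sym (δ-diag (_≟Idx_ {n}) i q))
      cases (no i≢j) = P.trans (eqGen-offdiag (X i) (X j) q (λ e → i≢j (X-injective e)))
                               (P.sym (δ-offdiag (_≟Idx_ {n}) i j q i≢j))

  negB : BElt D → BElt D
  negB = RawModule.-_ (G′ D)

  scB : BElt D → Scalar R → BElt D
  scB = RawModule._·_ (G′ D)

  coeff-++ : ∀ a b g → cf (a ++ b) g ≡ cf a g ℚ.+ cf b g
  coeff-++ [] b g = P.sym (ℚP.+-identityˡ _)
  coeff-++ ((h , r) ∷ a) b g = P.trans (P.cong (eqGen D h g (proj₁ r) ℚ.+_) (coeff-++ a b g))
                                        (P.sym (ℚP.+-assoc (eqGen D h g (proj₁ r)) (cf a g) (cf b g)))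

  coeff-neg : ∀ a g → cf (negB a) g ≡ ℚ.- cf a g
  coeff-neg [] g = P.refl
  coeff-neg ((h , r) ∷ a) g = P.trans (P.cong₂ ℚ._+_ (eqGen-neg h g (proj₁ r)) (coeff-neg a g))
                                       (P.sym (ℚP.neg-distrib-+ (eqGen D h g (proj₁ r)) (cf a g)))

  coeff-scB : ∀ a r g → cf (scB a r) g ≡ cf a g ℚ.* proj₁ r
  coeff-scB [] r g = P.sym (ℚP.*-zeroˡ (proj₁ r))
  coeff-scB ((h , s) ∷ a) r g = P.trans (P.cong₂ ℚ._+_ (eqGen-*ʳ h g (proj₁ s) (proj₁ r)) (coeff-scB a r g))
                                         (P.sym (ℚP.*-distribʳ-+ (proj₁ r) (eqGen D h g (proj₁ s)) (cf a g)))

  coeff-scB-+ˢ : ∀ b r s → cf (scB b (_+ˢ_ R r s)) P.≗ cf (scB b r ++ scB b s)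
  coeff-scB-+ˢ b r s g = begin
    cf (scB b (_+ˢ_ R r s)) g                   ≡⟨ coeff-scB b (_+ˢ_ R r s) g ⟩
    cf b g ℚ.* (proj₁ r ℚ.+ proj₁ s)            ≡⟨ ℚP.*-distribˡ-+ (cf b g) (proj₁ r) (proj₁ s) ⟩
    cf b g ℚ.* proj₁ r ℚ.+ cf b g ℚ.* proj₁ s   ≡⟨ P.sym (P.cong₂ ℚ._+_ (coeff-scB b r g) (coeff-scB b s g)) ⟩
    cf (scB b r) g ℚ.+ cf (scB b s) g           ≡⟨ P.sym (coeff-++ (scB b r) (scB b s) g) ⟩
    cf (scB b r ++ scB b s) g                   ∎
    where open P.≡-Reasoning

  coeff-scB-*ˢ : ∀ b r s → cf (scB b (_*ˢ_ R r s)) P.≗ cf (scB (scB b r) s)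
  coeff-scB-*ˢ b r s g = begin
    cf (scB b (_*ˢ_ R r s)) g                   ≡⟨ coeff-scB b (_*ˢ_ R r s) g ⟩
    cf b g ℚ.* (proj₁ r ℚ.* proj₁ s)            ≡⟨ P.sym (ℚP.*-assoc (cf b g) (proj₁ r) (proj₁ s)) ⟩
    (cf b g ℚ.* proj₁ r) ℚ.* proj₁ s            ≡⟨ P.sym (P.cong (ℚ._* proj₁ s) (coeff-scB b r g)) ⟩
    cf (scB b r) g ℚ.* proj₁ s                  ≡⟨ P.sym (coeff-scB (scB b r) s g) ⟩
    cf (scB (scB b r) s) g                      ∎
    where open P.≡-Reasoning

  coeff-mapX : ∀ (F : Idx n → Scalar R) l g →
               cf (map (λ i → X i , F i) l) g ≡ sumℚ (map (λ i → eqGen D (X i) g (proj₁ (F i))) l)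
  coeff-mapX F [] g = P.refl
  coeff-mapX F (i ∷ l) g = P.cong (eqGen D (X i) g (proj₁ (F i)) ℚ.+_) (coeff-mapX F l g)

  -- A relator combination  L = [(m₁ , r₁), …]  stands for  ρ_{m₁} r₁ + …  in N.
  RelComb : Set
  RelComb = List (ℕ × Scalar R)

  relComb : RelComb → Gen n → ℚ
  relComb L g = sumℚ (map (λ mr → proj₁ (proj₂ mr) ℚ.* relCoeff D (proj₁ mr) g) L)

  relWeight : RelComb → ℕ → ℚ
  relWeight L m = sumℚ (map (λ mr → δ ℕ._≟_ (proj₁ mr) m (proj₁ (proj₂ mr))) L)

  negRel : RelComb → RelComb
  negRel = map (λ mr → proj₁ mr , -ˢ_ R (proj₂ mr))

  scaleRel : RelComb → Scalar R → RelComb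
  scaleRel L s = map (λ mr → proj₁ mr , _*ˢ_ R (proj₂ mr) s) L

  relComb-++ : ∀ L₁ L₂ g → relComb (L₁ ++ L₂) g ≡ relComb L₁ g ℚ.+ relComb L₂ g
  relComb-++ L₁ L₂ g = P.trans (P.cong sumℚ (LP.map-++ term L₁ L₂)) (sumℚ-++ (map term L₁) (map term L₂))
    where term = λ (mr : ℕ × Scalar R) → proj₁ (proj₂ mr) ℚ.* relCoeff D (proj₁ mr) g

  relComb-neg : ∀ L g → relComb (negRel L) g ≡ ℚ.- relComb L g
  relComb-neg L g = P.trans (P.cong sumℚ (P.trans (P.sym (LP.map-∘ L)) (LP.map-cong neg-* L))) (sumℚ-neg _ L)
    where
      neg-* : ∀ (mr : ℕ × Scalar R) → (ℚ.- proj₁ (proj₂ mr)) ℚ.* relCoeff D (proj₁ mr) g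
                                    ≡ ℚ.- (proj₁ (proj₂ mr) ℚ.* relCoeff D (proj₁ mr) g)
      neg-* (m , r) = P.sym (ℚP.neg-distribˡ-* (proj₁ r) (relCoeff D m g))

  relComb-scale : ∀ L s g → relComb (scaleRel L s) g ≡ relComb L g ℚ.* proj₁ s
  relComb-scale L s g =
    P.trans (P.cong sumℚ (P.trans (P.sym (LP.map-∘ L)) (LP.map-cong *-swap L))) (sumℚ-*ʳ _ (proj₁ s) L)
    where
      *-swap : ∀ (mr : ℕ × Scalar R) → (proj₁ (proj₂ mr) ℚ.* proj₁ s) ℚ.* relCoeff D (proj₁ mr) g
                                     ≡ (proj₁ (proj₂ mr) ℚ.* relCoeff D (proj₁ mr) g) ℚ.* proj₁ s
      *-swap (m , r) = solve 3 (λ a b c → (a :* b) :* c := (a :* c) :* b) P.refl (proj₁ r) (proj₁ s) (relCoeff D m g)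

  infix 4 _∼_
  record _∼_ (f f′ : Gen n → ℚ) : Set where
    constructor via
    field
      witness    : RelComb
      difference : ∀ g → f g ℚ.- f′ g ≡ relComb witness g

  ≈⇒∼ : ∀ {a b} → RawModule._≈_ (G′ D) a b → cf a ∼ cf b
  ≈⇒∼ (L , e) = via L e

  ∼⇒≈ : ∀ {a b} → cf a ∼ cf b → RawModule._≈_ (G′ D) a b
  ∼⇒≈ (via L e) = L , e

  ∼-reflexive : ∀ {f f′} → f P.≗ f′ → f ∼ f′
  ∼-reflexive {f′ = f′} f≗f′ = via [] (λ g → P.trans (P.cong (ℚ._- f′ g) (f≗f′ g)) (ℚP.+-inverseʳ (f′ g)))

  ∼-resp-≗ : ∀ {f f′ h h′} → f P.≗ h → f′ P.≗ h′ → h ∼ h′ → f ∼ f′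
  ∼-resp-≗ f≗h f′≗h′ (via L e) = via L (λ g → P.trans (P.cong₂ ℚ._-_ (f≗h g) (f′≗h′ g)) (e g))

  ∼-refl : ∀ {f} → f ∼ f
  ∼-refl = ∼-reflexive (λ _ → P.refl)

  G′-refl : ∀ b → RawModule._≈_ (G′ D) b b
  G′-refl b = ∼⇒≈ {b} {b} ∼-refl

  unit : Gen n → BElt D
  unit h = (h , 1ˢ R) ∷ []

  ∼-sym : ∀ {f f′} → f ∼ f′ → f′ ∼ f
  ∼-sym {f} {f′} (via L e) = via (negRel L) λ g →
    P.trans (b-a≡-[a-b] (f g) (f′ g)) (P.trans (P.cong ℚ.-_ (e g)) (P.sym (relComb-neg L g)))
    where b-a≡-[a-b] = solve 2 (λ a b → b :- a := :- (a :- b)) P.refl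

  ∼-trans : ∀ {f f′ f″} → f ∼ f′ → f′ ∼ f″ → f ∼ f″
  ∼-trans {f} {f′} {f″} (via L₁ e₁) (via L₂ e₂) = via (L₁ ++ L₂) λ g →
    P.trans (a-c≡[a-b]+[b-c] (f g) (f′ g) (f″ g))
            (P.trans (P.cong₂ ℚ._+_ (e₁ g) (e₂ g)) (P.sym (relComb-++ L₁ L₂ g)))
    where a-c≡[a-b]+[b-c] = solve 3 (λ a b c → a :- c := (a :- b) :+ (b :- c)) P.refl

  ∼-+ : ∀ {f₁ f₁′ f₂ f₂′} → f₁ ∼ f₁′ → f₂ ∼ f₂′ → (λ g → f₁ g ℚ.+ f₂ g) ∼ (λ g → f₁′ g ℚ.+ f₂′ g)
  ∼-+ {f₁} {f₁′} {f₂} {f₂′} (via L₁ e₁) (via L₂ e₂) = via (L₁ ++ L₂) λ g →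
    P.trans (interchange-sub (f₁ g) (f₂ g) (f₁′ g) (f₂′ g))
            (P.trans (P.cong₂ ℚ._+_ (e₁ g) (e₂ g)) (P.sym (relComb-++ L₁ L₂ g)))
    where interchange-sub = solve 4 (λ a b c d → (a :+ b) :- (c :+ d) := (a :- c) :+ (b :- d)) P.refl

  ∼-neg : ∀ {f f′} → f ∼ f′ → (λ g → ℚ.- f g) ∼ (λ g → ℚ.- f′ g)
  ∼-neg {f} {f′} (via L e) = via (negRel L) λ g →
    P.trans (-a--b≡-[a-b] (f g) (f′ g)) (P.trans (P.cong ℚ.-_ (e g)) (P.sym (relComb-neg L g)))
    where -a--b≡-[a-b] = solve 2 (λ a b → (:- a) :- (:- b) := :- (a :- b)) P.refl

  ∼-*ʳ : ∀ {f f′} (s : Scalar R) → f ∼ f′ → (λ g → f g ℚ.* proj₁ s) ∼ (λ g → f′ g ℚ.* proj₁ s)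
  ∼-*ʳ {f} {f′} s (via L e) = via (scaleRel L s) λ g →
    P.trans (as-bs≡[a-b]s (f g) (f′ g) (proj₁ s))
            (P.trans (P.cong (ℚ._* proj₁ s) (e g)) (P.sym (relComb-scale L s g)))
    where as-bs≡[a-b]s = solve 3 (λ a b s → (a :* s) :- (b :* s) := (a :- b) :* s) P.refl

  coeff-++-∼ : ∀ {b₁ b₁′ b₂ b₂′} → cf b₁ ∼ cf b₁′ → cf b₂ ∼ cf b₂′ → cf (b₁ ++ b₂) ∼ cf (b₁′ ++ b₂′)
  coeff-++-∼ {b₁} {b₁′} {b₂} {b₂′} w₁ w₂ =
    ∼-resp-≗ (coeff-++ b₁ b₂) (coeff-++ b₁′ b₂′) (∼-+ w₁ w₂)

  relatorLHS : ℕ → BElt D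
  relatorLHS m = (Y (suc m) , p D m) ∷ []

  relatorRHS : ℕ → BElt D
  relatorRHS m = (Y m , 1ˢ R) ∷ map (λ i → X i , k D i m) (supp D m)

  relCoeff-suc : ∀ m → relCoeff D m (Y (suc m)) ≡ proj₁ (p D m)
  relCoeff-suc m with suc m ℕ.≟ suc m | suc m ℕ.≟ m
  ... | yes _ | _ = P.refl
  ... | no m≢m | _ = ⊥-elim (m≢m P.refl)

  relCoeff-self : ∀ m → relCoeff D m (Y m) ≡ ℚ.- 1ℚ
  relCoeff-self m with m ℕ.≟ suc m | m ℕ.≟ m
  ... | yes m≡1+m | _ = ⊥-elim (ℕP.1+n≢n (P.sym m≡1+m))
  ... | no _ | yes _ = P.refl
  ... | no _ | no m≢m = ⊥-elim (m≢m P.refl)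

  relCoeff-other : ∀ m j → j ≢ suc m → j ≢ m → relCoeff D m (Y j) ≡ 0ℚ
  relCoeff-other m j j≢1+m j≢m with j ℕ.≟ suc m | j ℕ.≟ m
  ... | yes e | _ = ⊥-elim (j≢1+m e)
  ... | no _ | yes e = ⊥-elim (j≢m e)
  ... | no _ | no _ = P.refl

  coeff-supp-X : ∀ m j → cf (map (λ i → X i , k D i m) (supp D m)) (X j) ≡ proj₁ (k D j m)
  coeff-supp-X m j = P.trans (coeff-mapX (λ i → k D i m) (supp D m) (X j))
    (P.trans (sumℚ-cong (supp D m) (λ i → eqGen-X-δ i j (proj₁ (k D i m)))) (sumℚ-supp-δ n D m j))

  coeff-supp-Y : ∀ m j → cf (map (λ i → X i , k D i m) (supp D m)) (Y j) ≡ 0ℚ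
  coeff-supp-Y m j = P.trans (coeff-mapX (λ i → k D i m) (supp D m) (Y j)) (sumℚ-zero _ (supp D m) (λ i → P.refl))

  coeff-relator-sides : ∀ m g → cf (relatorLHS m) g ℚ.- cf (relatorRHS m) g ≡ relCoeff D m g
  coeff-relator-sides m (X j) = P.trans (P.cong (λ z → (0ℚ ℚ.+ 0ℚ) ℚ.- (0ℚ ℚ.+ z)) (coeff-supp-X m j))
                                  (solve 1 (λ x → (con 0ℚ :+ con 0ℚ) :- (con 0ℚ :+ x) := :- x) P.refl (proj₁ (k D j m)))
  coeff-relator-sides m (Y j) =
    P.trans (P.cong (λ z → (eqGen D (Y (suc m)) (Y j) (proj₁ (p D m)) ℚ.+ 0ℚ) ℚ.- (eqGen D (Y m) (Y j) 1ℚ ℚ.+ z))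
                    (coeff-supp-Y m j))
            (cases (j ℕ.≟ suc m) (j ℕ.≟ m))
    where
      cases : Dec (j ≡ suc m) → Dec (j ≡ m) →
              (eqGen D (Y (suc m)) (Y j) (proj₁ (p D m)) ℚ.+ 0ℚ) ℚ.- (eqGen D (Y m) (Y j) 1ℚ ℚ.+ 0ℚ) ≡ relCoeff D m (Y j)
      cases (yes P.refl) _
        rewrite eqGen-diag (Y (suc m)) (proj₁ (p D m))
              | eqGen-offdiag (Y m) (Y (suc m)) 1ℚ (λ e → ℕP.1+n≢n (P.sym (Y-injective e)))
              | relCoeff-suc m
        = solve 1 (λ x → (x :+ con 0ℚ) :- (con 0ℚ :+ con 0ℚ) := x) P.refl (proj₁ (p D m))
      cases (no _) (yes P.refl)
        rewrite eqGen-offdiag (Y (suc j)) (Y j) (proj₁ (p D j)) (λ e → ℕP.1+n≢n (Y-injective e))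
              | eqGen-diag (Y j) 1ℚ
              | relCoeff-self j
        = P.refl
      cases (no j≢1+m) (no j≢m)
        rewrite eqGen-offdiag (Y (suc m)) (Y j) (proj₁ (p D m)) (λ e → j≢1+m (P.sym (Y-injective e)))
              | eqGen-offdiag (Y m) (Y j) 1ℚ (λ e → j≢m (P.sym (Y-injective e)))
              | relCoeff-other m j j≢1+m j≢m
        = P.refl

  relator-∼ : ∀ m → cf (relatorLHS m) ∼ cf (relatorRHS m)
  relator-∼ m = via ((m , 1ˢ R) ∷ []) λ g →
    P.trans (coeff-relator-sides m g) (solve 1 (λ x → x := con 1ℚ :* x :+ con 0ℚ) P.refl (relCoeff D m g))

  relComb-Y₀ : ∀ L → relComb L (Y 0) ≡ ℚ.- relWeight L 0
  relComb-Y₀ [] = P.refl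
  relComb-Y₀ ((m , r) ∷ L) =
    P.trans (P.cong₂ ℚ._+_ (term m) (relComb-Y₀ L)) (P.sym (ℚP.neg-distrib-+ (δ ℕ._≟_ m 0 (proj₁ r)) (relWeight L 0)))
    where
      term : ∀ m → proj₁ r ℚ.* relCoeff D m (Y 0) ≡ ℚ.- δ ℕ._≟_ m 0 (proj₁ r)
      term zero rewrite relCoeff-self 0 | δ-diag ℕ._≟_ 0 (proj₁ r) =
        solve 1 (λ x → x :* (:- con 1ℚ) := :- x) P.refl (proj₁ r)
      term (suc m) rewrite relCoeff-other (suc m) 0 (λ ()) (λ ()) | δ-offdiag ℕ._≟_ (suc m) 0 (proj₁ r) (λ ()) =
        ℚP.*-zeroʳ (proj₁ r)

  relComb-Y-suc : ∀ L j → relComb L (Y (suc j)) ≡ relWeight L j ℚ.* proj₁ (p D j) ℚ.- relWeight L (suc j)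
  relComb-Y-suc [] j = P.sym (solve 1 (λ p → con 0ℚ :* p :- con 0ℚ := con 0ℚ) P.refl (proj₁ (p D j)))
  relComb-Y-suc ((m , r) ∷ L) j =
    P.trans (P.cong₂ ℚ._+_ (term (m ℕ.≟ j) (m ℕ.≟ suc j)) (relComb-Y-suc L j))
            (collect (δ ℕ._≟_ m j (proj₁ r)) (δ ℕ._≟_ m (suc j) (proj₁ r))
                     (relWeight L j) (relWeight L (suc j)) (proj₁ (p D j)))
    where
      collect = solve 5 (λ a b a′ b′ p → (a :* p :- b) :+ (a′ :* p :- b′) := (a :+ a′) :* p :- (b :+ b′)) P.refl
      term : Dec (m ≡ j) → Dec (m ≡ suc j) →
             proj₁ r ℚ.* relCoeff D m (Y (suc j))
               ≡ δ ℕ._≟_ m j (proj₁ r) ℚ.* proj₁ (p D j) ℚ.- δ ℕ._≟_ m (suc j) (proj₁ r)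
      term (yes P.refl) _
        rewrite relCoeff-suc m | δ-diag ℕ._≟_ m (proj₁ r)
              | δ-offdiag ℕ._≟_ m (suc m) (proj₁ r) (λ e → ℕP.1+n≢n (P.sym e))
        = solve 2 (λ r p → r :* p := r :* p :- con 0ℚ) P.refl (proj₁ r) (proj₁ (p D m))
      term (no _) (yes P.refl)
        rewrite relCoeff-self (suc j) | δ-offdiag ℕ._≟_ (suc j) j (proj₁ r) ℕP.1+n≢n
              | δ-diag ℕ._≟_ (suc j) (proj₁ r)
        = solve 2 (λ r p → r :* (:- con 1ℚ) := con 0ℚ :* p :- r) P.refl (proj₁ r) (proj₁ (p D j))
      term (no m≢j) (no m≢1+j)
        rewrite relCoeff-other m (suc j) (λ e → m≢j (ℕP.suc-injective (P.sym e))) (λ e → m≢1+j (P.sym e))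
              | δ-offdiag ℕ._≟_ m j (proj₁ r) m≢j | δ-offdiag ℕ._≟_ m (suc j) (proj₁ r) m≢1+j
        = solve 2 (λ r p → r :* con 0ℚ := con 0ℚ :* p :- con 0ℚ) P.refl (proj₁ r) (proj₁ (p D j))

  relators-independent : ∀ L → (∀ g → relComb L g ≡ 0ℚ) → ∀ m → relWeight L m ≡ 0ℚ
  relators-independent L L≡0 zero = begin
    relWeight L 0              ≡⟨ solve 1 (λ x → x := :- (:- x)) P.refl (relWeight L 0) ⟩
    ℚ.- (ℚ.- relWeight L 0)    ≡⟨ P.cong ℚ.-_ (P.trans (P.sym (relComb-Y₀ L)) (L≡0 (Y 0))) ⟩
    ℚ.- 0ℚ                     ≡⟨⟩
    0ℚ                         ∎
    where open P.≡-Reasoning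
  relators-independent L L≡0 (suc j) = begin
    w₁                                ≡⟨ solve 3 (λ a p x → x := a :* p :- (a :* p :- x)) P.refl w₀ pj w₁ ⟩
    w₀ ℚ.* pj ℚ.- (w₀ ℚ.* pj ℚ.- w₁)  ≡⟨ P.cong₂ ℚ._-_ (P.cong (ℚ._* pj) (relators-independent L L≡0 j))
                                                       (P.trans (P.sym (relComb-Y-suc L j)) (L≡0 (Y (suc j)))) ⟩
    0ℚ ℚ.* pj ℚ.- 0ℚ                  ≡⟨ solve 1 (λ p → con 0ℚ :* p :- con 0ℚ := con 0ℚ) P.refl pj ⟩
    0ℚ                                ∎
    where
      open P.≡-Reasoning
      pj = proj₁ (p D j)
      w₀ = relWeight L j
      w₁ = relWeight L (suc j)

-- The pushout of  N ↪ B  along the map  N → G,  ρ_m ↦ c_m.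
module Pushout {R : Subring} (G : Module R) {n : ℕω} (D : FreeBy1Data R n) (c : ℕ → Module.Carrier G) where
  open Presentation D
  open ModuleProperties G
  open VanishingCombination G ℕ._≟_ (δ ℕ._≟_) (δ-diag ℕ._≟_) (δ-offdiag ℕ._≟_) c using (term; ∑-weightless)
  open SetoidReasoning setoid

  cSum : RelComb → Carrier
  cSum = ∑ term

  cSum-++ : ∀ L₁ L₂ → cSum (L₁ ++ L₂) ≈ (cSum L₁ + cSum L₂)
  cSum-++ = ∑-++ term

  cSum-neg : ∀ L → cSum (negRel L) ≈ (- cSum L)
  cSum-neg L = trans (∑-map term _ L) (trans (∑-cong L (λ (m , r) → ·-negʳ (c m) r)) (∑-neg term L))

  cSum-scale : ∀ L s → cSum (scaleRel L s) ≈ (cSum L · s)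
  cSum-scale L s = trans (∑-map term _ L) (trans (∑-cong L (λ (m , r) → ·-assoc (c m) r s)) (∑-· term s L))

  -- Well defined on N, because the relators are independent.
  cSum-cong : ∀ L L′ → relComb L P.≗ relComb L′ → cSum L ≈ cSum L′
  cSum-cong L L′ L≗L′ = x∙y⁻¹≈ε⇒x≈y (cSum L) (cSum L′) (begin
      cSum L + (- cSum L′)       ≈⟨ ∙-congˡ (sym (cSum-neg L′)) ⟩
      cSum L + cSum (negRel L′)  ≈⟨ sym (cSum-++ L (negRel L′)) ⟩
      cSum (L ++ negRel L′)      ≈⟨ ∑-weightless (L ++ negRel L′) (relators-independent (L ++ negRel L′) vanishes) ⟩
      0#                         ∎)
    where
      vanishes : ∀ g → relComb (L ++ negRel L′) g ≡ 0ℚ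
      vanishes g = P.trans (relComb-++ L (negRel L′) g)
                     (P.trans (P.cong₂ ℚ._+_ (L≗L′ g) (relComb-neg L′ g)) (ℚP.+-inverseʳ (relComb L′ g)))

  ECarrier : Set
  ECarrier = Carrier × BElt D

  infix 4 _≈E_
  record _≈E_ (x y : ECarrier) : Set where
    constructor mk≈E
    field
      coefficients : cf (proj₂ x) ∼ cf (proj₂ y)
      shift        : proj₁ x ≈ (proj₁ y + cSum (_∼_.witness coefficients))

  _+E_ : ECarrier → ECarrier → ECarrier
  (a , b) +E (a′ , b′) = a + a′ , b ++ b′

  0E : ECarrier
  0E = 0# , []

  -E_ : ECarrier → ECarrier
  -E (a , b) = - a , negB b

  _·E_ : ECarrier → Scalar R → ECarrier
  (a , b) ·E r = a · r , scB b r

  ≈E-pointwise : ∀ {a a′ b b′} → a ≈ a′ → cf b P.≗ cf b′ → (a , b) ≈E (a′ , b′)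
  ≈E-pointwise a≈a′ b≗b′ = mk≈E (∼-reflexive b≗b′) (trans a≈a′ (sym (identityʳ _)))

  ≈E-refl : ∀ {x} → x ≈E x
  ≈E-refl = ≈E-pointwise refl (λ _ → P.refl)

  ≈E-sym : ∀ {x y} → x ≈E y → y ≈E x
  ≈E-sym {a , b} {a′ , b′} (mk≈E w@(via L e) a≈) = mk≈E (∼-sym w)
    (trans (sym (x≈z∙y⇒x∙y⁻¹≈z a (cSum L) a′ a≈)) (∙-congˡ (sym (cSum-neg L))))

  ≈E-trans : ∀ {x y z} → x ≈E y → y ≈E z → x ≈E z
  ≈E-trans {a , _} {a′ , _} {a″ , _} (mk≈E w₁@(via L₁ _) a≈) (mk≈E w₂@(via L₂ _) a′≈) =
    mk≈E (∼-trans w₁ w₂) (begin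
      a                              ≈⟨ a≈ ⟩
      a′ + cSum L₁                   ≈⟨ ∙-congʳ a′≈ ⟩
      (a″ + cSum L₂) + cSum L₁       ≈⟨ assoc _ _ _ ⟩
      a″ + (cSum L₂ + cSum L₁)       ≈⟨ ∙-congˡ (comm _ _) ⟩
      a″ + (cSum L₁ + cSum L₂)       ≈⟨ ∙-congˡ (sym (cSum-++ L₁ L₂)) ⟩
      a″ + cSum (L₁ ++ L₂)           ∎)

  ≈E-+-cong : ∀ {x x′ y y′} → x ≈E x′ → y ≈E y′ → (x +E y) ≈E (x′ +E y′)
  ≈E-+-cong {a , b₁} {a′ , b₁′} {d , b₂} {d′ , b₂′} (mk≈E w₁@(via L₁ _) a≈) (mk≈E w₂@(via L₂ _) d≈) =
    mk≈E (coeff-++-∼ {b₁} {b₁′} {b₂} {b₂′} w₁ w₂) (begin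
      a + d                                ≈⟨ ∙-cong a≈ d≈ ⟩
      (a′ + cSum L₁) + (d′ + cSum L₂)      ≈⟨ interchange _ _ _ _ ⟩
      (a′ + d′) + (cSum L₁ + cSum L₂)      ≈⟨ ∙-congˡ (sym (cSum-++ L₁ L₂)) ⟩
      (a′ + d′) + cSum (L₁ ++ L₂)          ∎)

  ≈E-neg-cong : ∀ {x y} → x ≈E y → (-E x) ≈E (-E y)
  ≈E-neg-cong {a , b} {a′ , b′} (mk≈E w@(via L e) a≈) =
    mk≈E (∼-resp-≗ (coeff-neg b) (coeff-neg b′) (∼-neg w)) (begin
      - a                          ≈⟨ ⁻¹-cong a≈ ⟩
      - (a′ + cSum L)              ≈⟨ sym (⁻¹-∙-comm _ _) ⟩
      (- a′) + (- cSum L)          ≈⟨ ∙-congˡ (sym (cSum-neg L)) ⟩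
      (- a′) + cSum (negRel L)     ∎)

  ≈E-·-cong : ∀ {x y} {r s : Scalar R} → x ≈E y → proj₁ r ≡ proj₁ s → (x ·E r) ≈E (y ·E s)
  ≈E-·-cong {a , b} {a′ , b′} {r} {s} (mk≈E w@(via L e) a≈) r≡s =
    mk≈E (∼-resp-≗ (coeff-scB b r) (λ g → P.trans (coeff-scB b′ s g) (P.cong (cf b′ g ℚ.*_) (P.sym r≡s)))
                   (∼-*ʳ r w))
    (begin
      a · r                          ≈⟨ ·-cong₁ r a≈ ⟩
      (a′ + cSum L) · r              ≈⟨ ·-distribˡ _ _ r ⟩
      (a′ · r) + (cSum L · r)        ≈⟨ ∙-cong (·-cong₂ a′ r≡s) (sym (cSum-scale L r)) ⟩
      (a′ · s) + cSum (scaleRel L r) ∎)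

  +E-assoc : ∀ x y z → ((x +E y) +E z) ≈E (x +E (y +E z))
  +E-assoc (a , b) (a′ , b′) (a″ , b″) =
    ≈E-pointwise (assoc a a′ a″) (λ g → P.cong (λ l → cf l g) (LP.++-assoc b b′ b″))

  +E-identityˡ : ∀ x → (0E +E x) ≈E x
  +E-identityˡ (a , b) = ≈E-pointwise (identityˡ a) (λ _ → P.refl)

  +E-identityʳ : ∀ x → (x +E 0E) ≈E x
  +E-identityʳ (a , b) = ≈E-pointwise (identityʳ a) (λ g → P.cong (λ l → cf l g) (LP.++-identityʳ b))

  +E-inverseˡ : ∀ x → ((-E x) +E x) ≈E 0E
  +E-inverseˡ (a , b) = ≈E-pointwise (inverseˡ a) λ g →
    P.trans (coeff-++ (negB b) b g) (P.trans (P.cong (ℚ._+ cf b g) (coeff-neg b g)) (ℚP.+-inverseˡ (cf b g)))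

  +E-inverseʳ : ∀ x → (x +E (-E x)) ≈E 0E
  +E-inverseʳ (a , b) = ≈E-pointwise (inverseʳ a) λ g →
    P.trans (coeff-++ b (negB b) g) (P.trans (P.cong (cf b g ℚ.+_) (coeff-neg b g)) (ℚP.+-inverseʳ (cf b g)))

  +E-comm : ∀ x y → (x +E y) ≈E (y +E x)
  +E-comm (a , b) (a′ , b′) = ≈E-pointwise (comm a a′) λ g →
    P.trans (coeff-++ b b′ g) (P.trans (ℚP.+-comm (cf b g) (cf b′ g)) (P.sym (coeff-++ b′ b g)))

  ·E-distribˡ : ∀ x y r → ((x +E y) ·E r) ≈E ((x ·E r) +E (y ·E r))
  ·E-distribˡ (a , b) (a′ , b′) r =
    ≈E-pointwise (·-distribˡ a a′ r) (λ g → P.cong (λ l → cf l g) (LP.map-++ _ b b′))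

  ·E-distribʳ : ∀ x r s → (x ·E (_+ˢ_ R r s)) ≈E ((x ·E r) +E (x ·E s))
  ·E-distribʳ (a , b) r s = ≈E-pointwise (·-distribʳ a r s) (coeff-scB-+ˢ b r s)

  ·E-assoc : ∀ x r s → (x ·E (_*ˢ_ R r s)) ≈E ((x ·E r) ·E s)
  ·E-assoc (a , b) r s = ≈E-pointwise (·-assoc a r s) (coeff-scB-*ˢ b r s)

  ·E-identity : ∀ x → (x ·E 1ˢ R) ≈E x
  ·E-identity (a , b) = ≈E-pointwise (·-identity a) (λ g → P.trans (coeff-scB b (1ˢ R) g) (ℚP.*-identityʳ _))

  E-isModule : IsModule R _≈E_ _+E_ 0E -E_ _·E_
  E-isModule = record
    { isAbelianGroup = record
      { isGroup = record
        { isMonoid = record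
          { isSemigroup = record
            { isMagma = record
              { isEquivalence = record { refl = ≈E-refl ; sym = ≈E-sym ; trans = ≈E-trans }
              ; ∙-cong = ≈E-+-cong }
            ; assoc = +E-assoc }
          ; identity = +E-identityˡ , +E-identityʳ }
        ; inverse = +E-inverseˡ , +E-inverseʳ
        ; ⁻¹-cong = ≈E-neg-cong }
      ; comm = +E-comm }
    ; ·-cong = ≈E-·-cong
    ; ·-distribˡ = ·E-distribˡ
    ; ·-distribʳ = ·E-distribʳ
    ; ·-assoc = ·E-assoc
    ; ·-identity = ·E-identity
    }

  E : Module R
  E = record { raw = record { Carrier = ECarrier ; _≈_ = _≈E_ ; _+_ = _+E_ ; 0# = 0E ; -_ = -E_ ; _·_ = _·E_ }
             ; isModule = E-isModule }

  shift-by : ∀ {a a′ b b′} → (a , b) ≈E (a′ , b′) → (w : cf b ∼ cf b′) → a ≈ (a′ + cSum (_∼_.witness w))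
  shift-by (mk≈E w′ a≈) w = trans a≈ (∙-congˡ (cSum-cong (_∼_.witness w′) (_∼_.witness w) λ g →
    P.trans (P.sym (_∼_.difference w′ g)) (_∼_.difference w g)))

  cSum-relator : ∀ m → cSum ((m , 1ˢ R) ∷ []) ≈ c m
  cSum-relator m = trans (identityʳ _) (·-identity (c m))

  ι : Hom (raw G) (raw E)
  ι = record { ⟦_⟧ = λ a → a , [] ; cong = λ a≈b → ≈E-pointwise a≈b (λ _ → P.refl)
             ; hom-+ = λ _ _ → ≈E-refl ; hom-· = λ _ _ → ≈E-refl }

  π : Hom (raw E) (G′ D)
  π = record { ⟦_⟧ = proj₂ ; cong = λ {x} {y} x≈y → ∼⇒≈ {proj₂ x} {proj₂ y} (_≈E_.coefficients x≈y)
             ; hom-+ = λ x y → G′-refl (proj₂ x ++ proj₂ y) ; hom-· = λ x r → G′-refl (scB (proj₂ x) r) }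

  ι-injective : ∀ a a′ → (a , []) ≈E (a′ , []) → a ≈ a′
  ι-injective a a′ a≈ = trans (shift-by a≈ ∼-refl) (identityʳ a′)

  π-surjective : ∀ b → Σ ECarrier λ x → RawModule._≈_ (G′ D) (proj₂ x) b
  π-surjective b = (0# , b) , G′-refl b

  ker-π⊆im-ι : ∀ x → RawModule._≈_ (G′ D) (proj₂ x) [] → Σ Carrier λ a → (a , []) ≈E x
  ker-π⊆im-ι (a , b) b≈0 = a + cSum (negRel L) , mk≈E (∼-sym w) refl
    where
      w = ≈⇒∼ {b} {[]} b≈0
      L = _∼_.witness w

module SplittingSolves {R : Subring} (G : Module R) {n : ℕω} (D : FreeBy1Data R n) (c : ℕ → Module.Carrier G)
    (s : Hom (G′ D) (raw (Pushout.E G D c)))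
    (section : ∀ b → RawModule._≈_ (G′ D) (proj₂ (⟦ s ⟧ b)) b) where
  open Presentation D
  open ModuleProperties G
  open Pushout G D c
  module EP = ModuleProperties E

  section-∼ : ∀ b → cf (proj₂ (⟦ s ⟧ b)) ∼ cf b
  section-∼ b = ≈⇒∼ {proj₂ (⟦ s ⟧ b)} {b} (section b)

  z : Gen n → Carrier
  z h = proj₁ (⟦ s ⟧ (unit h)) + (- cSum (_∼_.witness (section-∼ (unit h))))

  s-unit : ∀ h → ⟦ s ⟧ (unit h) ≈E (z h , unit h)
  s-unit h = mk≈E (section-∼ (unit h)) (x∙y⁻¹≈z⇒x≈z∙y _ _ _ refl)

  s-generator : ∀ h r → ⟦ s ⟧ ((h , r) ∷ []) ≈E (z h · r , (h , r) ∷ [])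
  s-generator h r = begin
    ⟦ s ⟧ ((h , r) ∷ [])                  ≈⟨ Hom.cong s (∼⇒≈ {(h , r) ∷ []} {scB (unit h) r} (∼-reflexive λ g →
                                                P.cong (λ q → eqGen D h g q ℚ.+ 0ℚ) (P.sym (ℚP.*-identityˡ (proj₁ r))))) ⟩
    ⟦ s ⟧ (scB (unit h) r)                ≈⟨ hom-· s (unit h) r ⟩
    ⟦ s ⟧ (unit h) ·E r                   ≈⟨ ≈E-·-cong (s-unit h) P.refl ⟩
    (z h , unit h) ·E r                   ≈⟨ ≈E-pointwise refl (λ g →
                                                P.cong (λ q → eqGen D h g q ℚ.+ 0ℚ) (ℚP.*-identityˡ (proj₁ r))) ⟩
    (z h · r , (h , r) ∷ [])              ∎
    where open SetoidReasoning EP.setoid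

  zterm : Gen n × Scalar R → Carrier
  zterm (h , r) = z h · r

  s-normal-form : ∀ b → ⟦ s ⟧ b ≈E (∑ zterm b , b)
  s-normal-form [] = EP.identityʳ-unique (⟦ s ⟧ []) (⟦ s ⟧ []) (EP.sym (hom-+ s [] []))
  s-normal-form ((h , r) ∷ b) =
    EP.trans (hom-+ s ((h , r) ∷ []) b) (≈E-+-cong (s-generator h r) (s-normal-form b))

  solves : ∀ m → (z (Y (suc m)) · p D m) ≈ ((z (Y m) + sumM G (map (λ i → z (X i) · k D i m) (supp D m))) + c m)
  solves m = begin
    z (Y (suc m)) · p D m                              ≈⟨ sym (identityʳ _) ⟩
    ∑ zterm (relatorLHS m)                             ≈⟨ shift-by relator-images (relator-∼ m) ⟩
    ∑ zterm (relatorRHS m) + cSum ((m , 1ˢ R) ∷ [])    ≈⟨ ∙-cong (∙-cong (·-identity _) (∑-map zterm _ (supp D m)))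
                                                                  (cSum-relator m) ⟩
    (z (Y m) + ∑ (λ i → z (X i) · k D i m) (supp D m)) + c m ∎
    where
      open SetoidReasoning setoid
      relator-images : (∑ zterm (relatorLHS m) , relatorLHS m) ≈E (∑ zterm (relatorRHS m) , relatorRHS m)
      relator-images = EP.trans (EP.sym (s-normal-form (relatorLHS m)))
                         (EP.trans (Hom.cong s (∼⇒≈ {relatorLHS m} {relatorRHS m} (relator-∼ m)))
                                   (s-normal-form (relatorRHS m)))

Ext0⇒Complete : ∀ {R : Subring} (G : Module R) {n : ℕω} (D : FreeBy1Data R n) → Ext0 (G′ D) G → Complete D G
Ext0⇒Complete G D ext c = (λ m → z (Y m)) , (λ i → z (X i)) , solves
  where
    open Presentation D using (G′-refl)
    open Pushout G D c
    splitting = ext E ι π ι-injective π-surjective ker-π⊆im-ι (λ _ → G′-refl [])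
    open SplittingSolves G D c (proj₁ splitting) (proj₂ splitting)

module LiftingSplits {R : Subring} (G : Module R) {n : ℕω} (D : FreeBy1Data R n) (complete : Complete D G)
    (E : Module R) (f : Hom (raw G) (raw E)) (g : Hom (raw E) (G′ D))
    (g-surjective : ∀ b → Σ (Module.Carrier E) λ e → RawModule._≈_ (G′ D) (⟦ g ⟧ e) b)
    (ker-g⊆im-f : ∀ e → RawModule._≈_ (G′ D) (⟦ g ⟧ e) [] → Σ (Module.Carrier G) λ a → Module._≈_ E (⟦ f ⟧ a) e)
    (im-f⊆ker-g : ∀ a → RawModule._≈_ (G′ D) (⟦ g ⟧ (⟦ f ⟧ a)) []) where
  open Presentation D
  module GP = ModuleProperties G
  open ModuleProperties E

  f-0 : ⟦ f ⟧ GP.0# ≈ 0#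
  f-0 = identityʳ-unique _ _ (trans (sym (hom-+ f GP.0# GP.0#)) (Hom.cong f (GP.identityˡ GP.0#)))

  γ : Carrier → Gen n → ℚ
  γ e = cf (⟦ g ⟧ e)

  γ-cong : ∀ {e e′} → e ≈ e′ → γ e ∼ γ e′
  γ-cong {e} {e′} e≈e′ = ≈⇒∼ {⟦ g ⟧ e} {⟦ g ⟧ e′} (Hom.cong g e≈e′)

  γ-+ : ∀ e e′ → γ (e + e′) ∼ (λ x → γ e x ℚ.+ γ e′ x)
  γ-+ e e′ = ∼-resp-≗ (λ _ → P.refl) (λ x → P.sym (coeff-++ (⟦ g ⟧ e) (⟦ g ⟧ e′) x))
                      (≈⇒∼ {⟦ g ⟧ (e + e′)} {⟦ g ⟧ e ++ ⟦ g ⟧ e′} (hom-+ g e e′))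

  γ-· : ∀ e r → γ (e · r) ∼ (λ x → γ e x ℚ.* proj₁ r)
  γ-· e r = ∼-resp-≗ (λ _ → P.refl) (λ x → P.sym (coeff-scB (⟦ g ⟧ e) r x))
                     (≈⇒∼ {⟦ g ⟧ (e · r)} {scB (⟦ g ⟧ e) r} (hom-· g e r))

  γ-f : ∀ a → γ (⟦ f ⟧ a) ∼ (λ _ → 0ℚ)
  γ-f a = ≈⇒∼ {⟦ g ⟧ (⟦ f ⟧ a)} {[]} (im-f⊆ker-g a)

  γ-0 : γ 0# ∼ (λ _ → 0ℚ)
  γ-0 = ∼-trans (γ-cong (sym f-0)) (γ-f GP.0#)

  extend : (Gen n → Carrier) → BElt D → Carrier
  extend u = ∑ (λ (h , r) → u h · r)

  γ-extend : ∀ u → (∀ h → γ (u h) ∼ cf (unit h)) → ∀ b → γ (extend u b) ∼ cf b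
  γ-extend u u-lifts [] = γ-0
  γ-extend u u-lifts ((h , r) ∷ b) =
    ∼-trans (γ-+ (u h · r) (extend u b))
            (∼-resp-≗ (λ _ → P.refl) coeff-cons
                      (∼-+ (∼-trans (γ-· (u h) r) (∼-*ʳ r (u-lifts h))) (γ-extend u u-lifts b)))
    where
      coeff-cons : cf ((h , r) ∷ b) P.≗ (λ x → cf (unit h) x ℚ.* proj₁ r ℚ.+ cf b x)
      coeff-cons x = P.cong (ℚ._+ cf b x) (begin
        eqGen D h x (proj₁ r)                 ≡⟨ P.cong (eqGen D h x) (P.sym (ℚP.*-identityˡ (proj₁ r))) ⟩
        eqGen D h x (1ℚ ℚ.* proj₁ r)          ≡⟨ eqGen-*ʳ h x 1ℚ (proj₁ r) ⟩
        eqGen D h x 1ℚ ℚ.* proj₁ r            ≡⟨ P.cong (ℚ._* proj₁ r) (P.sym (ℚP.+-identityʳ (eqGen D h x 1ℚ))) ⟩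
        (eqGen D h x 1ℚ ℚ.+ 0ℚ) ℚ.* proj₁ r   ∎)
        where open P.≡-Reasoning

  lift : Gen n → Carrier
  lift h = proj₁ (g-surjective (unit h))

  lift-∼ : ∀ h → γ (lift h) ∼ cf (unit h)
  lift-∼ h = ≈⇒∼ {⟦ g ⟧ (lift h)} {unit h} (proj₂ (g-surjective (unit h)))

  relator : ℕ → BElt D
  relator m = relatorLHS m ++ negB (relatorRHS m)

  coeff-relator : ∀ m → cf (relator m) P.≗ relComb ((m , 1ˢ R) ∷ [])
  coeff-relator m x = P.trans (coeff-++ (relatorLHS m) (negB (relatorRHS m)) x)
                        (P.trans (P.cong (cf (relatorLHS m) x ℚ.+_) (coeff-neg (relatorRHS m) x))
                                 (_∼_.difference (relator-∼ m) x))

  relator-∼0 : ∀ m → cf (relator m) ∼ (λ _ → 0ℚ)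
  relator-∼0 m = via ((m , 1ˢ R) ∷ []) λ x → P.trans (ℚP.+-identityʳ (cf (relator m) x)) (coeff-relator m x)

  defect-exists : ∀ m → Σ (Module.Carrier G) λ a → ⟦ f ⟧ a ≈ extend lift (relator m)
  defect-exists m = ker-g⊆im-f (extend lift (relator m))
    (∼⇒≈ {⟦ g ⟧ (extend lift (relator m))} {[]} (∼-trans (γ-extend lift lift-∼ (relator m)) (relator-∼0 m)))

  defect : ℕ → Module.Carrier G
  defect m = proj₁ (defect-exists m)

  solution = complete (λ m → GP.- defect m)

  z : Gen n → Module.Carrier G
  z (X i) = proj₁ (proj₂ solution) i
  z (Y m) = proj₁ solution m

  corrected : Gen n → Carrier
  corrected h = lift h + ⟦ f ⟧ (z h)

  corrected-∼ : ∀ h → γ (corrected h) ∼ cf (unit h)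
  corrected-∼ h = ∼-trans (γ-+ (lift h) (⟦ f ⟧ (z h)))
                          (∼-resp-≗ (λ _ → P.refl) (λ x → P.sym (ℚP.+-identityʳ (cf (unit h) x)))
                                    (∼-+ (lift-∼ h) (γ-f (z h))))

  ζ : BElt D → Module.Carrier G
  ζ = GP.∑ (λ (h , r) → z h GP.· r)

  extend-corrected : ∀ b → extend corrected b ≈ (extend lift b + ⟦ f ⟧ (ζ b))
  extend-corrected [] = sym (trans (∙-congˡ f-0) (identityʳ 0#))
  extend-corrected ((h , r) ∷ b) = begin
    (corrected h · r) + extend corrected b
      ≈⟨ ∙-cong (trans (·-distribˡ (lift h) (⟦ f ⟧ (z h)) r) (∙-congˡ (sym (hom-· f (z h) r))))
                (extend-corrected b) ⟩
    ((lift h · r) + ⟦ f ⟧ (z h GP.· r)) + (extend lift b + ⟦ f ⟧ (ζ b))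
      ≈⟨ interchange _ _ _ _ ⟩
    ((lift h · r) + extend lift b) + (⟦ f ⟧ (z h GP.· r) + ⟦ f ⟧ (ζ b))
      ≈⟨ ∙-congˡ (sym (hom-+ f (z h GP.· r) (ζ b))) ⟩
    ((lift h · r) + extend lift b) + ⟦ f ⟧ ((z h GP.· r) GP.+ ζ b) ∎
    where open SetoidReasoning setoid

  ζ-neg : ∀ b → ζ (negB b) GP.≈ (GP.- ζ b)
  ζ-neg b = GP.trans (GP.∑-map _ _ b) (GP.trans (GP.∑-cong b (λ (h , r) → GP.·-negʳ (z h) r)) (GP.∑-neg _ b))

  ζ-relator : ∀ m → ζ (relator m) GP.≈ (GP.- defect m)
  ζ-relator m = GP.trans (GP.∑-++ _ (relatorLHS m) (negB (relatorRHS m)))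
                  (GP.trans (GP.∙-congˡ (ζ-neg (relatorRHS m)))
                    (GP.x≈z∙y⇒x∙y⁻¹≈z _ _ _ (GP.trans (GP.identityʳ _)
                      (GP.trans (proj₂ (proj₂ solution) m) (GP.trans (GP.comm _ _) (GP.∙-congˡ (GP.sym ζ-RHS)))))))
    where
      ζ-RHS : ζ (relatorRHS m) GP.≈ (z (Y m) GP.+ sumM G (map (λ i → z (X i) GP.· k D i m) (supp D m)))
      ζ-RHS = GP.∙-cong (GP.·-identity (z (Y m))) (GP.∑-map _ (λ i → X i , k D i m) (supp D m))

  extend-corrected-relator : ∀ m → extend corrected (relator m) ≈ 0#
  extend-corrected-relator m = begin
    extend corrected (relator m)                              ≈⟨ extend-corrected (relator m) ⟩
    extend lift (relator m) + ⟦ f ⟧ (ζ (relator m))           ≈⟨ ∙-cong (sym (proj₂ (defect-exists m))) (Hom.cong f (ζ-relator m)) ⟩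
    ⟦ f ⟧ (defect m) + ⟦ f ⟧ (GP.- defect m)                  ≈⟨ sym (hom-+ f (defect m) (GP.- defect m)) ⟩
    ⟦ f ⟧ (defect m GP.+ (GP.- defect m))                     ≈⟨ Hom.cong f (GP.inverseʳ (defect m)) ⟩
    ⟦ f ⟧ GP.0#                                               ≈⟨ f-0 ⟩
    0#                                                        ∎
    where open SetoidReasoning setoid

  extend-neg : ∀ u b → extend u (negB b) ≈ (- extend u b)
  extend-neg u b = trans (∑-map _ _ b) (trans (∑-cong b (λ (h , r) → ·-negʳ (u h) r)) (∑-neg _ b))

  extend-scB : ∀ u b r → extend u (scB b r) ≈ (extend u b · r)
  extend-scB u b r = trans (∑-map _ _ b) (trans (∑-cong b (λ (h , s) → ·-assoc (u h) s r)) (∑-· _ r b))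

  relatorsOf : RelComb → BElt D
  relatorsOf [] = []
  relatorsOf ((m , r) ∷ L) = scB (relator m) r ++ relatorsOf L

  coeff-relatorsOf : ∀ L → cf (relatorsOf L) P.≗ relComb L
  coeff-relatorsOf [] x = P.refl
  coeff-relatorsOf ((m , r) ∷ L) x = P.trans (coeff-++ (scB (relator m) r) (relatorsOf L) x)
    (P.cong₂ ℚ._+_ (P.trans (coeff-scB (relator m) r x)
                            (P.trans (P.cong (ℚ._* proj₁ r) (coeff-relator m x))
                                     (solve 2 (λ a r → (con 1ℚ :* a :+ con 0ℚ) :* r := r :* a) P.refl
                                              (relCoeff D m x) (proj₁ r))))
                   (coeff-relatorsOf L x))

  extend-corrected-relatorsOf : ∀ L → extend corrected (relatorsOf L) ≈ 0#
  extend-corrected-relatorsOf [] = refl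
  extend-corrected-relatorsOf ((m , r) ∷ L) = trans (∑-++ _ (scB (relator m) r) (relatorsOf L))
    (trans (∙-cong (trans (extend-scB corrected (relator m) r)
                          (trans (·-cong₁ r (extend-corrected-relator m)) (·-zeroˡ r)))
                   (extend-corrected-relatorsOf L))
           (identityˡ 0#))

  open VanishingCombination E _≟Gen_ (eqGen D) eqGen-diag eqGen-offdiag corrected using (∑-weightless)

  -- b − b′ is a combination of relators, on which  extend corrected  vanishes.
  extend-corrected-cong : ∀ {b b′} → RawModule._≈_ (G′ D) b b′ → extend corrected b ≈ extend corrected b′
  extend-corrected-cong {b} {b′} (L , b-b′≡L) = x∙y⁻¹≈ε⇒x≈y _ _ (begin
    ext b + (- ext b′)                                         ≈⟨ ∙-congˡ (sym (identityʳ _)) ⟩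
    ext b + ((- ext b′) + 0#)                                  ≈⟨ ∙-congˡ (∙-congˡ (sym (trans (⁻¹-cong
                                                                    (extend-corrected-relatorsOf L)) ε⁻¹≈ε))) ⟩
    ext b + ((- ext b′) + (- ext (relatorsOf L)))              ≈⟨ ∙-congˡ (sym (∙-cong (extend-neg corrected b′)
                                                                    (extend-neg corrected (relatorsOf L)))) ⟩
    ext b + (ext (negB b′) + ext (negB (relatorsOf L)))        ≈⟨ ∙-congˡ (sym (∑-++ _ (negB b′) (negB (relatorsOf L)))) ⟩
    ext b + ext (negB b′ ++ negB (relatorsOf L))               ≈⟨ sym (∑-++ _ b (negB b′ ++ negB (relatorsOf L))) ⟩
    ext difference                                             ≈⟨ ∑-weightless difference weightless ⟩
    0#                                                         ∎)
    where
      open SetoidReasoning setoid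
      ext = extend corrected
      difference = b ++ (negB b′ ++ negB (relatorsOf L))
      weightless : ∀ x → cf difference x ≡ 0ℚ
      weightless x = P.trans (coeff-++ b _ x)
        (P.trans (P.cong (cf b x ℚ.+_)
                   (P.trans (coeff-++ (negB b′) (negB (relatorsOf L)) x)
                     (P.cong₂ ℚ._+_ (coeff-neg b′ x)
                       (P.trans (coeff-neg (relatorsOf L) x)
                                (P.cong ℚ.-_ (P.trans (coeff-relatorsOf L x) (P.sym (b-b′≡L x))))))))
                 (solve 2 (λ a b → a :+ ((:- b) :+ (:- (a :- b))) := con 0ℚ) P.refl (cf b x) (cf b′ x)))

  section : Hom (G′ D) (raw E)
  section = record { ⟦_⟧ = extend corrected ; cong = λ {b} {b′} → extend-corrected-cong {b} {b′}
                   ; hom-+ = ∑-++ _ ; hom-· = extend-scB corrected }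

  splits : ∀ b → RawModule._≈_ (G′ D) (⟦ g ⟧ (⟦ section ⟧ b)) b
  splits b = ∼⇒≈ {⟦ g ⟧ (extend corrected b)} {b} (γ-extend corrected corrected-∼ b)

Complete⇒Ext0 : ∀ {R : Subring} (G : Module R) {n : ℕω} (D : FreeBy1Data R n) → Complete D G → Ext0 (G′ D) G
Complete⇒Ext0 G D complete E f g _ g-surjective ker-g⊆im-f im-f⊆ker-g = section , splits
  where open LiftingSplits G D complete E f g g-surjective ker-g⊆im-f im-f⊆ker-g

mainTheorem2 : (R : Subring) (G : Module R) → TorsionFree G → NucleusIs R G →
    (n : ℕω) (D : FreeBy1Data R n) → NotFree D →
    (Ext0 (G′ D) G → Complete D G) × (Complete D G → Ext0 (G′ D) G)
mainTheorem2 R G _ _ n D _ = Ext0⇒Complete G D , Complete⇒Ext0 G D
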